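{- Assume the standing assumption on $f$ from the context, and fix $\alpha\in\{a,\bar a\}$ such that: - $L^f_\alpha$ holds and $R^f_\alpha$ does not; - $R^f_{\bar\alpha}$ holds and $L^f_{\bar\alpha}$ does not; - $S^f_{\bar\alpha,\alpha}$ holds and $S^f_{\alpha,\bar\alpha}$ does not. For $n\ge0$ let $p_n=\sum_{i=0}^n\bar\alpha.\alpha^{\le i}$. Let $t\approx u$ be an equation between CCS$_f^-$ terms that is sound modulo bisimilarity, let $\sigma$ be a closed substitution, and put $p=\sigma(t)$, $q=\sigma(u)$. Suppose that $p$ and $q$ have neither $\mathbf 0$ summands nor $\mathbf 0$ factors, and that $p\,\underline{\leftrightarrow}\,f(\alpha,p_n)$ and $q\,\underline{\leftrightarrow}\,f(\alpha,p_n)$ for some $n$ larger than the size of $t$. If $p$ has a summand bisimilar to $f(\alpha,p_n)$, then so does $q$.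
   Context: Actions: $\mathcal A=\{a,\bar a,\tau\}$ with $a\ne\bar a$, $\bar{\bar a}=a$. CCS$_f^-$ terms: $t::=\mathbf 0\mid x\mid \mu.t\mid t+t\mid f(t,t)$. Semantics on closed terms: - $\mu.x\xrightarrow{\mu}x$; - standard choice; - standard CCS parallel composition $\parallel$ (interleaving, plus $\tau$-synchronisation of $\beta,\bar\beta$), which occurs in targets; - the rules for $f$. Standing assumption on $f$: every rule of $f$ has one of the following forms: (S$_{\beta}$) $\dfrac{x_1\xrightarrow{\beta}y_1\ \ x_2\xrightarrow{\bar\beta}y_2}{f(x_1,x_2)\xrightarrow{\tau}y_1\parallel y_2}$ with $\beta\in\{a,\bar a\}$; (L$_\mu$) $\dfrac{x_1\xrightarrow{\mu}y_1}{f(x_1,x_2)\xrightarrow{\mu}y_1\parallel x_2}$; (R$_\mu$) $\dfrac{x_2\xrightarrow{\mu}y_2}{f(x_1,x_2)\xrightarrow{\mu}x_1\parallel y_2}$. Moreover, $f$ has at least one S rule, and for each $\mu$ at least one of L$_\mu$, R$_\mu$. $L^f_\mu$, $R^f_\mu$, $S^f_{\beta,\bar\beta}$ hold iff $f$ has the respective rule. $\underline{\leftrightarrow}$ is strong bisimilarity; $t\approx u$ is sound if $\sigma(t)\,\underline{\leftrightarrow}\,\sigma(u)$ for all closed $\sigma$. A term has a $\mathbf 0$ factor if it contains a subterm $f(t',t'')$ with $t'$ or $t''$ bisimilar to $\mathbf 0$, and a $\mathbf 0$ summand if it contains a subterm $t'+t''$ with $t'$ or $t''$ bisimilar to $\mathbf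 0$. Terms are modulo associativity and commutativity of $+$; the summands of $t_1+\dots+t_k$, with no $t_i$ headed by $+$, are the $t_i$. Size is the number of operator symbols. Notation: $\mu^0=\mathbf 0$, $\mu^{m+1}=\mu.\mu^m$, $\mu^{\le i}=\mu+\dots+\mu^i$ (with $\mu^{\le 0}=\mathbf 0$); $\alpha$ abbreviates $\alpha.\mathbf 0$. -}

module Defs where

open import Data.Nat using (ℕ; zero; suc; _+_)
open import Data.Bool using (Bool; true; false)
open import Data.Empty using (⊥)
open import Data.Product using (Σ; _×_; _,_; ∃)
open import Data.Sum using (_⊎_)
open import Relation.Binary.PropositionalEquality using (_≡_)

data Name : Set where
  a ā : Name

bar : Name → Name
bar a = ā
bar ā = a

data Act : Set where
  vis : Name → Act
  τ   : Act

-- L μ ≡ true  iff f has rule (L_μ)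
--   R μ ≡ true  iff f has rule (R_μ)
--   S β ≡ true  iff f has rule (S_β), i.e. S^f_{β, bar β}:
--        x₁ --β--> y₁ , x₂ --bar β--> y₂  ⟹  f(x₁,x₂) --τ--> y₁ ∥ y₂

record Rules : Set where
  field
    L : Act → Bool
    R : Act → Bool
    S : Name → Bool
open Rules public

record Standing (ρ : Rules) : Set where
  field
    someS : ∃ λ β → S ρ β ≡ true
    LorR  : ∀ μ → L ρ μ ≡ true ⊎ R ρ μ ≡ true

infixr 20 _·_
infixl 10 _⊕_

data Tm (X : Set) : Set where
  𝟎   : Tm X
  var : X → Tm X
  _·_ : Act → Tm X → Tm X
  _⊕_ : Tm X → Tm X → Tm X
  F   : Tm X → Tm X → Tm X

Closed : Set
Closed = Tm ⊥

subst : {X Y : Set} → (X → Tm Y) → Tm X → Tm Y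
subst σ 𝟎       = 𝟎
subst σ (var x) = σ x
subst σ (μ · t) = μ · subst σ t
subst σ (t ⊕ u) = subst σ t ⊕ subst σ u
subst σ (F t u) = F (subst σ t) (subst σ u)

-- Size: number of operator symbols (𝟎, prefixing, +, f); variables
-- are not operator symbols.
size : {X : Set} → Tm X → ℕ
size 𝟎       = 1
size (var x) = 0
size (μ · t) = suc (size t)
size (t ⊕ u) = suc (size t + size u)
size (F t u) = suc (size t + size u)

-- Closed process terms used by the semantics: closed CCS_f^- terms
-- extended with CCS parallel composition (which appears in targets).

data Proc : Set where
  𝟎   : Proc
  _·_ : Act → Proc → Proc
  _⊕_ : Proc → Proc → Proc
  F   : Proc → Proc → Proc
  _∥_ : Proc → Proc → Proc

emb : Closed → Proc
emb 𝟎       = 𝟎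
emb (var ())
emb (μ · t) = μ · emb t
emb (t ⊕ u) = emb t ⊕ emb u
emb (F t u) = F (emb t) (emb u)

data Step (ρ : Rules) : Proc → Act → Proc → Set where
  pre   : ∀ {μ p} → Step ρ (μ · p) μ p
  sumL  : ∀ {p q μ p'} → Step ρ p μ p' → Step ρ (p ⊕ q) μ p'
  sumR  : ∀ {p q μ q'} → Step ρ q μ q' → Step ρ (p ⊕ q) μ q'
  parL  : ∀ {p q μ p'} → Step ρ p μ p' → Step ρ (p ∥ q) μ (p' ∥ q)
  parR  : ∀ {p q μ q'} → Step ρ q μ q' → Step ρ (p ∥ q) μ (p ∥ q')
  parS  : ∀ {p q p' q'} β → Step ρ p (vis β) p' → Step ρ q (vis (bar β)) q' →
          Step ρ (p ∥ q) τ (p' ∥ q')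
  fL    : ∀ {p q μ p'} → L ρ μ ≡ true → Step ρ p μ p' → Step ρ (F p q) μ (p' ∥ q)
  fR    : ∀ {p q μ q'} → R ρ μ ≡ true → Step ρ q μ q' → Step ρ (F p q) μ (p ∥ q')
  fS    : ∀ {p q p' q'} β → S ρ β ≡ true →
          Step ρ p (vis β) p' → Step ρ q (vis (bar β)) q' →
          Step ρ (F p q) τ (p' ∥ q')

IsBisim : Rules → (Proc → Proc → Set) → Set
IsBisim ρ 𝓡 = ∀ {p q} → 𝓡 p q →
  (∀ {μ p'} → Step ρ p μ p' → Σ Proc λ q' → Step ρ q μ q' × 𝓡 p' q') ×
  (∀ {μ q'} → Step ρ q μ q' → Σ Proc λ p' → Step ρ p μ p' × 𝓡 p' q')

Bisim : Rules → Proc → Proc → Set₁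
Bisim ρ p q = Σ (Proc → Proc → Set) λ 𝓡 → IsBisim ρ 𝓡 × 𝓡 p q

_⊢_↔_ : Rules → Closed → Closed → Set₁
ρ ⊢ p ↔ q = Bisim ρ (emb p) (emb q)

Sound : Rules → Tm ℕ → Tm ℕ → Set₁
Sound ρ t u = (σ : ℕ → Closed) → ρ ⊢ subst σ t ↔ subst σ u

data SubTm {X : Set} : Tm X → Tm X → Set where
  here  : ∀ {t} → SubTm t t
  pre   : ∀ {s μ t} → SubTm s t → SubTm s (μ · t)
  sumL  : ∀ {s t u} → SubTm s t → SubTm s (t ⊕ u)
  sumR  : ∀ {s t u} → SubTm s u → SubTm s (t ⊕ u)
  argL  : ∀ {s t u} → SubTm s t → SubTm s (F t u)
  argR  : ∀ {s t u} → SubTm s u → SubTm s (F t u)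

HasZeroFactor : Rules → Closed → Set₁
HasZeroFactor ρ p = Σ Closed λ t' → Σ Closed λ t'' →
  SubTm (F t' t'') p × (ρ ⊢ t' ↔ 𝟎 ⊎ ρ ⊢ t'' ↔ 𝟎)

HasZeroSummand : Rules → Closed → Set₁
HasZeroSummand ρ p = Σ Closed λ t' → Σ Closed λ t'' →
  SubTm (t' ⊕ t'') p × (ρ ⊢ t' ↔ 𝟎 ⊎ ρ ⊢ t'' ↔ 𝟎)

data NotSum {X : Set} : Tm X → Set where
  z  : NotSum 𝟎
  v  : ∀ {x} → NotSum (var x)
  pr : ∀ {μ t} → NotSum (μ · t)
  f  : ∀ {t u} → NotSum (F t u)

data Summand {X : Set} : Tm X → Tm X → Set where
  here  : ∀ {t} → NotSum t → Summand t t
  left  : ∀ {s t u} → Summand s t → Summand s (t ⊕ u)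
  right : ∀ {s t u} → Summand s u → Summand s (t ⊕ u)

pow : {X : Set} → Act → ℕ → Tm X
pow μ zero    = 𝟎
pow μ (suc m) = μ · pow μ m

powLe : {X : Set} → Act → ℕ → Tm X
powLe μ zero          = 𝟎
powLe μ (suc zero)    = pow μ 1
powLe μ (suc (suc i)) = powLe μ (suc i) ⊕ pow μ (suc (suc i))

pSeq : {X : Set} → Name → ℕ → Tm X
pSeq α zero    = vis (bar α) · powLe (vis α) 0
pSeq α (suc n) = pSeq α n ⊕ vis (bar α) · powLe (vis α) (suc n)

-- f(α, p_n)  (α abbreviates α.𝟎)
target : {X : Set} → Name → ℕ → Tm X
target α n = F (vis α · 𝟎) (pSeq α n)

-- Write T = f(α, pₙ). Its only α-derivative is 𝟎 ∥ pₙ, its ᾱ-derivatives are the n + 1 processes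
-- α ∥ α^{≤i}, told apart by the lengths of their α-runs, and no τ ever follows an ᾱ.
-- A summand of σ(t) bisimilar to T is neither 𝟎 nor a prefix, so it lies in σ(x) for a summand x
-- of t, or it is σ(f(t₁, t₂)); then t₂ is too small to supply n + 1 ᾱ-derivatives by itself, so
-- some variable y exposed in t₂ has an ᾱ-move. Adding the marker ᾱ.τ to σ(y) (to σ(x) in the
-- first case) gives σ(t) an ᾱ-move followed by τ, which by soundness σ(u) must match after the same
-- marking. Since σ(u) ∼ T, the match comes from the marker at a summand y of u, or from a summand
-- f(u₁, u₂) of u whose right argument can do ᾱ. In the latter case f(σu₁, σu₂) ∼ T: its moves are
-- moves of σ(u), and counting α-runs shows that it reaches every ᾱ-derivative of T.

module Submission where

open import Defs
open import Data.Bool using (true; false) renaming (_≟_ to _≟ᵇ_)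
open import Data.Empty using (⊥; ⊥-elim)
open import Data.Fin using (Fin; toℕ)
open import Data.Fin.Properties using (toℕ<n; pigeonhole)
open import Data.List using (List; []; _∷_; _++_; map; length)
open import Data.List.Properties using (length-++; length-map)
open import Data.List.Membership.Propositional using (_∈_)
open import Data.List.Membership.Propositional.Properties using (∈-++⁺ˡ; ∈-++⁺ʳ; ∈-map⁺)
open import Data.List.Relation.Unary.Any using (here; index)
open import Data.List.Membership.Setoid.Properties using (index-injective)
open import Data.Nat using (ℕ; zero; suc; _+_; _<_; _≤_; _⊔_; z≤n; s≤s; s≤s⁻¹)
open import Data.Nat.Properties
open import Data.Product using (Σ; _×_; _,_; proj₁; proj₂)
open import Data.Sum using (_⊎_; inj₁; inj₂; [_,_]′)
open import Data.Unit using (⊤; tt)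
open import Relation.Nullary using (¬_; Dec; yes; no)
open import Relation.Nullary.Decidable using (map′; _×-dec_; _⊎-dec_; decidable-stable)
open import Relation.Binary.PropositionalEquality using (_≡_; _≢_; refl; sym; trans; cong; setoid)

true≢false : ∀ {b} → b ≡ true → b ≡ false → ⊥
true≢false refl ()

bar-≢ : ∀ x → vis (bar x) ≢ vis x
bar-≢ a ()
bar-≢ ā ()

_≟ᴬ_ : (μ ν : Act) → Dec (μ ≡ ν)
vis a ≟ᴬ vis a = yes refl
vis ā ≟ᴬ vis ā = yes refl
τ     ≟ᴬ τ     = yes refl
vis a ≟ᴬ vis ā = no λ ()
vis ā ≟ᴬ vis a = no λ ()
vis _ ≟ᴬ τ     = no λ ()
τ     ≟ᴬ vis _ = no λ ()

∃-name? : {P : Name → Set} → (∀ β → Dec (P β)) → Dec (Σ Name P)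
∃-name? P? = map′ [ (a ,_) , (ā ,_) ]′ (λ { (a , p) → inj₁ p ; (ā , p) → inj₂ p }) (P? a ⊎-dec P? ā)

∃-act? : {P : Act → Set} → (∀ μ → Dec (P μ)) → Dec (Σ Act P)
∃-act? P? = map′ [ (λ (β , p) → vis β , p) , (τ ,_) ]′
                 (λ { (vis β , p) → inj₁ (β , p) ; (τ , p) → inj₂ p })
                 (∃-name? (λ β → P? (vis β)) ⊎-dec P? τ)

depth : Proc → ℕ
depth 𝟎       = 0
depth (μ · P) = suc (depth P)
depth (P ⊕ Q) = depth P ⊔ depth Q
depth (F P Q) = depth P + depth Q
depth (P ∥ Q) = depth P + depth Q

data Only (x : Name) : Proc → Set where
  only-𝟎 : Only x 𝟎
  only-· : ∀ {P} → Only x P → Only x (vis x · P)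
  only-⊕ : ∀ {P Q} → Only x P → Only x Q → Only x (P ⊕ Q)
  only-∥ : ∀ {P Q} → Only x P → Only x Q → Only x (P ∥ Q)

inst : (ℕ → Closed) → Tm ℕ → Proc
inst σ w = emb (subst σ w)

summand-subterm : ∀ {X} {s t : Tm X} → Summand s t → SubTm s t
summand-subterm (here _)  = here
summand-subterm (left h)  = sumL (summand-subterm h)
summand-subterm (right h) = sumR (summand-subterm h)

summand-size : ∀ {X} {s t : Tm X} → Summand s t → size s ≤ size t
summand-size (here _) = ≤-refl
summand-size {t = t ⊕ t'} (left h) = ≤-trans (summand-size h) (m≤n⇒m≤1+n (m≤m+n (size t) (size t')))
summand-size {t = t ⊕ t'} (right h) = ≤-trans (summand-size h) (m≤n⇒m≤1+n (m≤n+m (size t') (size t)))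

summand-subst-trans : ∀ {X Y} (σ : X → Tm Y) {s : Tm Y} {w u : Tm X} →
  Summand s (subst σ w) → Summand w u → Summand s (subst σ u)
summand-subst-trans σ h (here _)   = h
summand-subst-trans σ h (left h')  = left (summand-subst-trans σ h h')
summand-subst-trans σ h (right h') = right (summand-subst-trans σ h h')

data Origin (σ : ℕ → Closed) : Closed → Tm ℕ → Set where
  var    : ∀ {s x} → Summand s (σ x) → Origin σ s (var x)
  nil    : Origin σ 𝟎 𝟎
  prefix : ∀ {μ w} → Origin σ (μ · subst σ w) (μ · w)
  fun    : ∀ {w w'} → Origin σ (subst σ (F w w')) (F w w')

summand-origin : ∀ σ t {s} → Summand s (subst σ t) → Σ (Tm ℕ) λ w → Summand w t × Origin σ s w
summand-origin σ 𝟎        (here _)  = 𝟎 , here z , nil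
summand-origin σ (var x)  h         = var x , here v , var h
summand-origin σ (μ · t)  (here _)  = μ · t , here pr , prefix
summand-origin σ (t ⊕ t') (left h)  = let (w , h' , o) = summand-origin σ t h in w , left h' , o
summand-origin σ (t ⊕ t') (right h) = let (w , h' , o) = summand-origin σ t' h in w , right h' , o
summand-origin σ (F t t') (here _)  = F t t' , here f , fun

-- When f has (R_μ) but not (L_μ), these are the occurrences of y through which initial μ-moves
-- of σ(y) become initial moves of σ(w).
data Exposed (y : ℕ) : Tm ℕ → Set where
  here : Exposed y (var y)
  sumL : ∀ {w w'} → Exposed y w → Exposed y (w ⊕ w')
  sumR : ∀ {w w'} → Exposed y w' → Exposed y (w ⊕ w')
  argR : ∀ {w w'} → Exposed y w' → Exposed y (F w w')

summand-var-exposed : ∀ {x t} → Summand (var x) t → Exposed x t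
summand-var-exposed (here _)  = here
summand-var-exposed (left h)  = sumL (summand-var-exposed h)
summand-var-exposed (right h) = sumR (summand-var-exposed h)

exposedResiduals : (ℕ → Closed) → Tm ℕ → List Proc
exposedResiduals σ 𝟎        = []
exposedResiduals σ (var x)  = []
exposedResiduals σ (μ · w)  = inst σ w ∷ []
exposedResiduals σ (w ⊕ w') = exposedResiduals σ w ++ exposedResiduals σ w'
exposedResiduals σ (F w w') = map (inst σ w ∥_) (exposedResiduals σ w')

length-exposedResiduals : ∀ σ w → length (exposedResiduals σ w) ≤ size w
length-exposedResiduals σ 𝟎        = z≤n
length-exposedResiduals σ (var x)  = z≤n
length-exposedResiduals σ (μ · w)  = s≤s z≤n
length-exposedResiduals σ (w ⊕ w') = begin
  length (exposedResiduals σ w ++ exposedResiduals σ w')             ≡⟨ length-++ (exposedResiduals σ w) ⟩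
  length (exposedResiduals σ w) + length (exposedResiduals σ w')     ≤⟨ +-mono-≤ (length-exposedResiduals σ w) (length-exposedResiduals σ w') ⟩
  size w + size w'                                                   <⟨ n<1+n _ ⟩
  size (w ⊕ w')                                                      ∎
  where open ≤-Reasoning
length-exposedResiduals σ (F w w') = begin
  length (map (inst σ w ∥_) (exposedResiduals σ w'))  ≡⟨ length-map (inst σ w ∥_) (exposedResiduals σ w') ⟩
  length (exposedResiduals σ w')                       ≤⟨ length-exposedResiduals σ w' ⟩
  size w'                                              ≤⟨ m≤n+m (size w') (size w) ⟩
  size w + size w'                                     <⟨ n<1+n _ ⟩
  size (F w w')                                        ∎
  where open ≤-Reasoning

module Transitions (ρ : Rules) where

  infix 4 _—[_]→_ _∼_

  _—[_]→_ : Proc → Act → Proc → Set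
  P —[ μ ]→ P' = Step ρ P μ P'

  Can : Proc → Act → Set
  Can P μ = Σ Proc (P —[ μ ]→_)

  _∼_ : Proc → Proc → Set₁
  _∼_ = Bisim ρ

  can? : ∀ P μ → Dec (Can P μ)
  can? 𝟎 μ = no λ { (_ , ()) }
  can? (ν · P) μ = map′ (λ { refl → P , pre }) (λ { (_ , pre) → refl }) (ν ≟ᴬ μ)
  can? (P ⊕ Q) μ =
    map′ [ (λ (_ , s) → _ , sumL s) , (λ (_ , s) → _ , sumR s) ]′
         (λ { (_ , sumL s) → inj₁ (_ , s) ; (_ , sumR s) → inj₂ (_ , s) })
         (can? P μ ⊎-dec can? Q μ)
  can? (P ∥ Q) μ =
    map′ (λ { (inj₁ (_ , s)) → _ , parL s
            ; (inj₂ (inj₁ (_ , s))) → _ , parR s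
            ; (inj₂ (inj₂ (β , refl , (_ , s) , (_ , s')))) → _ , parS β s s' })
         (λ { (_ , parL s) → inj₁ (_ , s)
            ; (_ , parR s) → inj₂ (inj₁ (_ , s))
            ; (_ , parS β s s') → inj₂ (inj₂ (β , refl , (_ , s) , (_ , s'))) })
         (can? P μ ⊎-dec can? Q μ ⊎-dec
          ∃-name? λ β → (μ ≟ᴬ τ) ×-dec can? P (vis β) ×-dec can? Q (vis (bar β)))
  can? (F P Q) μ =
    map′ (λ { (inj₁ (l , _ , s)) → _ , fL l s
            ; (inj₂ (inj₁ (r , _ , s))) → _ , fR r s
            ; (inj₂ (inj₂ (β , refl , e , (_ , s) , (_ , s')))) → _ , fS β e s s' })
         (λ { (_ , fL l s) → inj₁ (l , _ , s)
            ; (_ , fR r s) → inj₂ (inj₁ (r , _ , s))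
            ; (_ , fS β e s s') → inj₂ (inj₂ (β , refl , e , (_ , s) , (_ , s'))) })
         ((L ρ μ ≟ᵇ true) ×-dec can? P μ ⊎-dec (R ρ μ ≟ᵇ true) ×-dec can? Q μ ⊎-dec
          ∃-name? λ β → (μ ≟ᴬ τ) ×-dec (S ρ β ≟ᵇ true) ×-dec can? P (vis β) ×-dec can? Q (vis (bar β)))

  ∼-step : ∀ {P Q μ P'} → P ∼ Q → P —[ μ ]→ P' → Σ Proc λ Q' → Q —[ μ ]→ Q' × P' ∼ Q'
  ∼-step (𝓡 , isB , r) s = let (Q' , s' , r') = proj₁ (isB r) s in Q' , s' , 𝓡 , isB , r'

  ∼-step⁻ : ∀ {P Q μ Q'} → P ∼ Q → Q —[ μ ]→ Q' → Σ Proc λ P' → P —[ μ ]→ P' × P' ∼ Q'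
  ∼-step⁻ (𝓡 , isB , r) s = let (P' , s' , r') = proj₂ (isB r) s in P' , s' , 𝓡 , isB , r'

  ⋃ : {I : Set} {X Y : I → Proc} → (∀ i → X i ∼ Y i) → Proc → Proc → Set
  ⋃ b P Q = Σ _ λ i → proj₁ (b i) P Q

  ⋃-isBisim : {I : Set} {X Y : I → Proc} (b : ∀ i → X i ∼ Y i) → IsBisim ρ (⋃ b)
  ⋃-isBisim b (i , r) =
    (λ s → let (Q' , s' , r') = proj₁ (proj₁ (proj₂ (b i)) r) s in Q' , s' , i , r') ,
    (λ s → let (P' , s' , r') = proj₂ (proj₁ (proj₂ (b i)) r) s in P' , s' , i , r')

  ⋃-∋ : {I : Set} {X Y : I → Proc} (b : ∀ i → X i ∼ Y i) → ∀ i → ⋃ b (X i) (Y i)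
  ⋃-∋ b i = i , proj₂ (proj₂ (b i))

  -- The bisimulations witnessing the derivatives' bisimilarity are glued along the Set-sized
  -- index of all moves of P and Q, which keeps the resulting relation Set-valued.
  ∼-intro : ∀ {P Q} →
    (∀ {μ P'} → P —[ μ ]→ P' → Σ Proc λ Q' → Q —[ μ ]→ Q' × P' ∼ Q') →
    (∀ {μ Q'} → Q —[ μ ]→ Q' → Σ Proc λ P' → P —[ μ ]→ P' × P' ∼ Q') →
    P ∼ Q
  ∼-intro {P} {Q} fwd bwd = 𝓡 , isB , inj₁ (refl , refl)
    where
    Move : Set
    Move = Σ Act (Can P) ⊎ Σ Act (Can Q)
    from to : Move → Proc
    from (inj₁ (_ , P' , _)) = P'
    from (inj₂ (_ , _ , s))  = proj₁ (bwd s)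
    to (inj₁ (_ , _ , s))  = proj₁ (fwd s)
    to (inj₂ (_ , Q' , _)) = Q'
    witness : ∀ m → from m ∼ to m
    witness (inj₁ (_ , _ , s)) = proj₂ (proj₂ (fwd s))
    witness (inj₂ (_ , _ , s)) = proj₂ (proj₂ (bwd s))
    𝓡 : Proc → Proc → Set
    𝓡 X Y = (X ≡ P × Y ≡ Q) ⊎ ⋃ witness X Y
    isB : IsBisim ρ 𝓡
    isB (inj₂ r) =
      (λ s → let (Q' , s' , r') = proj₁ (⋃-isBisim witness r) s in Q' , s' , inj₂ r') ,
      (λ s → let (P' , s' , r') = proj₂ (⋃-isBisim witness r) s in P' , s' , inj₂ r')
    isB (inj₁ (refl , refl)) =
      (λ s → proj₁ (fwd s) , proj₁ (proj₂ (fwd s)) , inj₂ (⋃-∋ witness (inj₁ (_ , _ , s)))) ,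
      (λ s → proj₁ (bwd s) , proj₁ (proj₂ (bwd s)) , inj₂ (⋃-∋ witness (inj₂ (_ , _ , s))))

  stuck-∼𝟎 : ∀ {P} → (∀ {μ P'} → ¬ P —[ μ ]→ P') → P ∼ 𝟎
  stuck-∼𝟎 stuck = ∼-intro (λ s → ⊥-elim (stuck s)) λ ()

  ≁𝟎⇒step : ∀ {P} → ¬ P ∼ 𝟎 → Σ Act (Can P)
  ≁𝟎⇒step {P} P≁𝟎 = decidable-stable (∃-act? (can? P)) λ ¬step → P≁𝟎 (stuck-∼𝟎 λ s → ¬step (_ , _ , s))

  step-depth : ∀ {P μ P'} → P —[ μ ]→ P' → depth P' < depth P
  step-depth pre = ≤-refl
  step-depth {P ⊕ Q} (sumL s) = <-≤-trans (step-depth s) (m≤m⊔n (depth P) (depth Q))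
  step-depth {P ⊕ Q} (sumR s) = <-≤-trans (step-depth s) (m≤n⊔m (depth P) (depth Q))
  step-depth {P ∥ Q} (parL s) = +-monoˡ-< (depth Q) (step-depth s)
  step-depth {P ∥ Q} (parR s) = +-monoʳ-< (depth P) (step-depth s)
  step-depth (parS _ s s') = +-mono-< (step-depth s) (step-depth s')
  step-depth {F P Q} (fL _ s) = +-monoˡ-< (depth Q) (step-depth s)
  step-depth {F P Q} (fR _ s) = +-monoʳ-< (depth P) (step-depth s)
  step-depth (fS _ _ s s') = +-mono-< (step-depth s) (step-depth s')

  Runs : Act → Proc → ℕ → Set
  Runs μ P zero    = ⊤
  Runs μ P (suc k) = Σ Proc λ P' → P —[ μ ]→ P' × Runs μ P' k

  runs-depth : ∀ {μ P} k → Runs μ P k → k ≤ depth P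
  runs-depth zero    _            = z≤n
  runs-depth (suc k) (_ , s , rs) = ≤-trans (s≤s (runs-depth k rs)) (step-depth s)

  ∼-runs : ∀ {μ P Q} → P ∼ Q → ∀ k → Runs μ P k → Runs μ Q k
  ∼-runs b zero    _            = tt
  ∼-runs b (suc k) (_ , s , rs) = let (Q' , s' , b') = ∼-step b s in Q' , s' , ∼-runs b' k rs

  ∼-runs⁻ : ∀ {μ P Q} → P ∼ Q → ∀ k → Runs μ Q k → Runs μ P k
  ∼-runs⁻ b zero    _            = tt
  ∼-runs⁻ b (suc k) (_ , s , rs) = let (P' , s' , b') = ∼-step⁻ b s in P' , s' , ∼-runs⁻ b' k rs

  runs-∥ʳ : ∀ {μ P Q} k → Runs μ Q k → Runs μ (P ∥ Q) k
  runs-∥ʳ zero    _            = tt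
  runs-∥ʳ (suc k) (_ , s , rs) = _ , parR s , runs-∥ʳ k rs

  runs-∥-split : ∀ {x P Q} k → Runs (vis x) (P ∥ Q) k →
    Σ ℕ λ k₁ → Σ ℕ λ k₂ → Runs (vis x) P k₁ × Runs (vis x) Q k₂ × k ≡ k₁ + k₂
  runs-∥-split zero _ = 0 , 0 , tt , tt , refl
  runs-∥-split (suc k) (_ , parL s , rs) =
    let (k₁ , k₂ , rs₁ , rs₂ , e) = runs-∥-split k rs in suc k₁ , k₂ , (_ , s , rs₁) , rs₂ , cong suc e
  runs-∥-split (suc k) (_ , parR s , rs) =
    let (k₁ , k₂ , rs₁ , rs₂ , e) = runs-∥-split k rs in
    k₁ , suc k₂ , rs₁ , (_ , s , rs₂) , trans (cong suc e) (sym (+-suc k₁ k₂))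

  only-step : ∀ {x P μ P'} → Only x P → P —[ μ ]→ P' → μ ≡ vis x × Only x P'
  only-step (only-· o) pre = refl , o
  only-step (only-⊕ o _) (sumL s) = only-step o s
  only-step (only-⊕ _ o) (sumR s) = only-step o s
  only-step (only-∥ o o') (parL s) = let (e , o₁) = only-step o s in e , only-∥ o₁ o'
  only-step (only-∥ o o') (parR s) = let (e , o₁) = only-step o' s in e , only-∥ o o₁
  only-step {x} (only-∥ o o') (parS β s s') with only-step o s | only-step o' s'
  ... | refl , _ | e , _ = ⊥-elim (bar-≢ x e)

  ∼-only : ∀ {x P W μ P'} → P ∼ W → Only x W → P —[ μ ]→ P' →
    μ ≡ vis x × Σ Proc λ W' → P' ∼ W' × Only x W'
  ∼-only b o s = let (W' , s' , b') = ∼-step b s ; (e , o') = only-step o s' in e , W' , b' , o'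

  summand-step : ∀ {s p : Closed} {μ X} → Summand s p → emb s —[ μ ]→ X → emb p —[ μ ]→ X
  summand-step (here _)  st = st
  summand-step (left h)  st = sumL (summand-step h st)
  summand-step (right h) st = sumR (summand-step h st)

  initials-mono : ∀ {σ θ} → (∀ x {μ} → Can (emb (σ x)) μ → Can (emb (θ x)) μ) →
    ∀ w {μ} → Can (inst σ w) μ → Can (inst θ w) μ
  initials-mono h (var x)  c                    = h x c
  initials-mono h (μ · w)  (_ , pre)            = _ , pre
  initials-mono h (w ⊕ w') (_ , sumL s)         = let (_ , s') = initials-mono h w (_ , s) in _ , sumL s'
  initials-mono h (w ⊕ w') (_ , sumR s)         = let (_ , s') = initials-mono h w' (_ , s) in _ , sumR s'
  initials-mono h (F w w') (_ , fL l s)         = let (_ , s') = initials-mono h w (_ , s) in _ , fL l s'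
  initials-mono h (F w w') (_ , fR r s)         = let (_ , s') = initials-mono h w' (_ , s) in _ , fR r s'
  initials-mono h (F w w') (_ , fS β e s₁ s₂)   =
    _ , fS β e (proj₂ (initials-mono h w (_ , s₁))) (proj₂ (initials-mono h w' (_ , s₂)))

module Target (ρ : Rules) (α : Name)
  (Lα : L ρ (vis α) ≡ true) (Rα : R ρ (vis α) ≡ false)
  (Rᾱ : R ρ (vis (bar α)) ≡ true) (Lᾱ : L ρ (vis (bar α)) ≡ false)
  (Sα : S ρ α ≡ false) where

  open Transitions ρ

  A Ā : Act
  A = vis α
  Ā = vis (bar α)

  αpow : ℕ → Proc
  αpow k = emb (pow A k)

  αpowLe : ℕ → Proc
  αpowLe i = emb (powLe A i)

  p : ℕ → Proc
  p n = emb (pSeq α n)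

  T : ℕ → Proc
  T n = emb (target α n)

  Tα : ℕ → Proc
  Tα n = 𝟎 ∥ p n

  Tᾱ : ℕ → Proc
  Tᾱ j = (A · 𝟎) ∥ αpowLe j

  only-αpow : ∀ k → Only α (αpow k)
  only-αpow zero    = only-𝟎
  only-αpow (suc k) = only-· (only-αpow k)

  only-αpowLe : ∀ i → Only α (αpowLe i)
  only-αpowLe zero          = only-𝟎
  only-αpowLe (suc zero)    = only-· only-𝟎
  only-αpowLe (suc (suc i)) = only-⊕ (only-αpowLe (suc i)) (only-αpow (suc (suc i)))

  runs-αpow : ∀ k → Runs A (αpow k) k
  runs-αpow zero    = tt
  runs-αpow (suc k) = _ , pre , runs-αpow k

  runs-αpowLe : ∀ i → Runs A (αpowLe i) i
  runs-αpowLe zero          = tt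
  runs-αpowLe (suc zero)    = _ , pre , tt
  runs-αpowLe (suc (suc i)) = _ , sumR pre , runs-αpow (suc i)

  depth-αpow : ∀ k → depth (αpow k) ≡ k
  depth-αpow zero    = refl
  depth-αpow (suc k) = cong suc (depth-αpow k)

  depth-αpowLe : ∀ i → depth (αpowLe i) ≤ i
  depth-αpowLe zero          = z≤n
  depth-αpowLe (suc zero)    = ≤-refl
  depth-αpowLe (suc (suc i)) =
    ⊔-lub (m≤n⇒m≤1+n (depth-αpowLe (suc i))) (≤-reflexive (depth-αpow (suc (suc i))))

  only-Tᾱ : ∀ j → Only α (Tᾱ j)
  only-Tᾱ j = only-∥ (only-· only-𝟎) (only-αpowLe j)

  runs-Tᾱ : ∀ j → Runs A (Tᾱ j) (suc j)
  runs-Tᾱ j = _ , parL pre , runs-∥ʳ j (runs-αpowLe j)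

  depth-Tᾱ : ∀ j → depth (Tᾱ j) ≤ suc j
  depth-Tᾱ j = s≤s (depth-αpowLe j)

  p-step : ∀ {n i} → i ≤ n → p n —[ Ā ]→ αpowLe i
  p-step {zero}  z≤n = pre
  p-step {suc n} {i} i≤1+n with i ≟ suc n
  ... | yes refl = sumR pre
  ... | no i≢1+n = sumL (p-step (s≤s⁻¹ (≤∧≢⇒< i≤1+n i≢1+n)))

  p-inv : ∀ {n μ X} → p n —[ μ ]→ X → μ ≡ Ā × Σ ℕ λ i → X ≡ αpowLe i
  p-inv {zero}  pre        = refl , 0 , refl
  p-inv {suc n} (sumL s)   = p-inv s
  p-inv {suc n} (sumR pre) = refl , suc n , refl

  T-α : ∀ {n} → T n —[ A ]→ Tα n
  T-α = fL Lα pre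

  T-ᾱ : ∀ {n i} → i ≤ n → T n —[ Ā ]→ Tᾱ i
  T-ᾱ i≤n = fR Rᾱ (p-step i≤n)

  T-inv : ∀ {n μ X} → T n —[ μ ]→ X → (μ ≡ A × X ≡ Tα n) ⊎ (μ ≡ Ā × Σ ℕ λ j → X ≡ Tᾱ j)
  T-inv (fL _ pre) = inj₁ (refl , refl)
  T-inv (fR _ s) with p-inv s
  ... | refl , j , refl = inj₂ (refl , j , refl)
  T-inv (fS _ Sα≡true pre _) = ⊥-elim (true≢false Sα≡true Sα)

  Tα-no-α : ∀ {n X} → ¬ Tα n —[ A ]→ X
  Tα-no-α (parR s) = bar-≢ α (sym (proj₁ (p-inv s)))

  ∼T-α : ∀ {n P P'} → P ∼ T n → P —[ A ]→ P' → P' ∼ Tα n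
  ∼T-α b s with ∼-step b s
  ... | _ , s' , b' with T-inv s'
  ...   | inj₁ (_ , refl) = b'
  ...   | inj₂ (Ā≡A , _)  = ⊥-elim (bar-≢ α (sym Ā≡A))

  ∼T-ᾱ : ∀ {n P P'} → P ∼ T n → P —[ Ā ]→ P' → Σ ℕ λ j → P' ∼ Tᾱ j
  ∼T-ᾱ b s with ∼-step b s
  ... | _ , s' , b' with T-inv s'
  ...   | inj₁ (Ā≡A , _)       = ⊥-elim (bar-≢ α Ā≡A)
  ...   | inj₂ (_ , j , refl) = j , b'

  ∼T-ᾱ-no-τ : ∀ {n P P'} → P ∼ T n → P —[ Ā ]→ P' → ¬ Can P' τ
  ∼T-ᾱ-no-τ b s (_ , s') with ∼T-ᾱ b s
  ... | j , b' with ∼-only b' (only-Tᾱ j) s'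
  ...   | () , _

  ∼Tᾱ-index-≤ : ∀ {X i j} → X ∼ Tᾱ i → X ∼ Tᾱ j → i ≤ j
  ∼Tᾱ-index-≤ {i = i} {j} bi bj =
    s≤s⁻¹ (≤-trans (runs-depth (suc i) (∼-runs bj (suc i) (∼-runs⁻ bi (suc i) (runs-Tᾱ i)))) (depth-Tᾱ j))

  -- U contributes at most one α to any α-run, so the maximal α-runs of U ∥ V and U₁ ∥ V differ by one.
  ∥-Tᾱ-index : ∀ {U U₁ V i j} → (∀ {k} → Runs A U k → k ≤ 1) → U —[ A ]→ U₁ →
    U₁ ∥ V ∼ 𝟎 ∥ αpowLe i → U ∥ V ∼ Tᾱ j → j ≡ i
  ∥-Tᾱ-index {U = U} {V = V} {i = i} {j = j} runs-U U→U₁ b₁ b = ≤-antisym j≤i i≤j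
    where
    i≤j : i ≤ j
    i≤j = s≤s⁻¹ (≤-trans (runs-depth (suc i) (∼-runs b (suc i) run)) (depth-Tᾱ j))
      where
      run : Runs A (U ∥ V) (suc i)
      run = _ , parL U→U₁ , ∼-runs⁻ b₁ i (runs-∥ʳ i (runs-αpowLe i))
    j≤i : j ≤ i
    j≤i with runs-∥-split (suc j) (∼-runs⁻ b (suc j) (runs-Tᾱ j))
    ... | k₁ , k₂ , rs₁ , rs₂ , e = s≤s⁻¹ (≤-trans (≤-reflexive e) (+-mono-≤ (runs-U rs₁) k₂≤i))
      where
      k₂≤i : k₂ ≤ i
      k₂≤i = ≤-trans (runs-depth k₂ (∼-runs b₁ k₂ (runs-∥ʳ k₂ rs₂))) (depth-αpowLe i)

  F-∼T : ∀ {n q U V} → (∀ {μ X} → F U V —[ μ ]→ X → q —[ μ ]→ X) → q ∼ T n →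
    ¬ U ∼ 𝟎 → Can V Ā → F U V ∼ T n
  F-∼T {n} {q} {U} {V} lift q∼T U≁𝟎 (V₀ , V→V₀) = ∼-intro fwd bwd
    where
    U-steps-α : ∀ {μ U'} → U —[ μ ]→ U' → μ ≡ A × Σ Proc λ W → U' ∥ V₀ ∼ W × Only α W
    U-steps-α s = let (j , b) = ∼T-ᾱ q∼T (lift (fR Rᾱ V→V₀)) in ∼-only b (only-Tᾱ j) (parL s)

    -- All moves of an α-derivative U' of U are α-moves, as U' ∥ V₀ is bisimilar to a process of
    -- Only α, and none is, as U' ∥ V ∼ Tα n.
    α-derivative-stuck : ∀ {U' μ U''} → U —[ A ]→ U' → ¬ U' —[ μ ]→ U''
    α-derivative-stuck s s' with U-steps-α s
    ... | _ , W , b , o with ∼-only b o (parL s')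
    ...   | refl , _ = let (_ , s'' , _) = ∼-step (∼T-α q∼T (lift (fL Lα s))) (parL s') in Tα-no-α s''

    runs-U : ∀ {k} → Runs A U k → k ≤ 1
    runs-U {zero}        _                   = z≤n
    runs-U {suc zero}    _                   = ≤-refl
    runs-U {suc (suc k)} (_ , s , _ , s' , _) = ⊥-elim (α-derivative-stuck s s')

    U-α : Can U A
    U-α with ≁𝟎⇒step U≁𝟎
    ... | _ , U₁ , s with U-steps-α s
    ...   | refl , _ = U₁ , s

    U₁∥V∼Tα : proj₁ U-α ∥ V ∼ Tα n
    U₁∥V∼Tα = ∼T-α q∼T (lift (fL Lα (proj₂ U-α)))

    fwd : ∀ {μ X} → F U V —[ μ ]→ X → Σ Proc λ Y → T n —[ μ ]→ Y × X ∼ Y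
    fwd s = ∼-step q∼T (lift s)

    bwd-ᾱ : ∀ {i} → p n —[ Ā ]→ αpowLe i → Σ Proc λ X → F U V —[ Ā ]→ X × X ∼ Tᾱ i
    bwd-ᾱ {i} st with ∼-step⁻ U₁∥V∼Tα (parR st)
    ... | _ , parL s , _ = ⊥-elim (α-derivative-stuck (proj₂ U-α) s)
    ... | _ , parR {q' = V'} s , b₁ with ∼T-ᾱ q∼T (lift (fR Rᾱ s))
    ...   | j , b with ∥-Tᾱ-index {i = i} {j} runs-U (proj₂ U-α) b₁ b
    ...     | refl = U ∥ V' , fR Rᾱ s , b

    bwd : ∀ {μ Y} → T n —[ μ ]→ Y → Σ Proc λ X → F U V —[ μ ]→ X × X ∼ Y
    bwd (fL _ pre) = _ , fL Lα (proj₂ U-α) , U₁∥V∼Tα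
    bwd (fR _ st) with p-inv st
    ... | refl , i , refl = bwd-ᾱ {i} st
    bwd (fS _ Sα≡true pre _) = ⊥-elim (true≢false Sα≡true Sα)

  𝟎-≁T : ∀ {n} → ¬ 𝟎 ∼ T n
  𝟎-≁T b with ∼-step⁻ b T-α
  ... | _ , () , _

  prefix-≁T : ∀ {n μ P} → ¬ (μ · P) ∼ T n
  prefix-≁T b with ∼-step⁻ b T-α | ∼-step⁻ b (T-ᾱ z≤n)
  ... | _ , s , _ | _ , s' , _ = bar-≢ α (trans (sym (prefix-label s')) (prefix-label s))
    where
    prefix-label : ∀ {μ ν P X} → (μ · P) —[ ν ]→ X → μ ≡ ν
    prefix-label pre = refl

  F∼T⇒left-α : ∀ {n P Q} → F P Q ∼ T n → Can P A
  F∼T⇒left-α b with ∼-step⁻ b T-α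
  ... | _ , fL _ s , _ = _ , s
  ... | _ , fR Rα≡true _ , _ = ⊥-elim (true≢false Rα≡true Rα)

  ᾱ-Exposed : (ℕ → Closed) → Tm ℕ → Set
  ᾱ-Exposed σ w = Σ ℕ λ y → Exposed y w × Can (emb (σ y)) Ā

  ᾱ-exposed? : ∀ σ w → Dec (ᾱ-Exposed σ w)
  ᾱ-exposed? σ 𝟎        = no λ { (_ , () , _) }
  ᾱ-exposed? σ (var x)  = map′ (λ c → x , here , c) (λ { (_ , here , c) → c }) (can? (emb (σ x)) Ā)
  ᾱ-exposed? σ (μ · w)  = no λ { (_ , () , _) }
  ᾱ-exposed? σ (w ⊕ w') =
    map′ [ (λ (y , e , c) → y , sumL e , c) , (λ (y , e , c) → y , sumR e , c) ]′
         (λ { (y , sumL e , c) → inj₁ (y , e , c) ; (y , sumR e , c) → inj₂ (y , e , c) })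
         (ᾱ-exposed? σ w ⊎-dec ᾱ-exposed? σ w')
  ᾱ-exposed? σ (F w w') =
    map′ (λ (y , e , c) → y , argR e , c) (λ { (y , argR e , c) → y , e , c }) (ᾱ-exposed? σ w')

  ᾱ-derivative-source : ∀ σ w {V} → inst σ w —[ Ā ]→ V → ᾱ-Exposed σ w ⊎ V ∈ exposedResiduals σ w
  ᾱ-derivative-source σ (var x)  s = inj₁ (x , here , _ , s)
  ᾱ-derivative-source σ (μ · w)  pre = inj₂ (here refl)
  ᾱ-derivative-source σ (w ⊕ w') (sumL s) with ᾱ-derivative-source σ w s
  ... | inj₁ (y , e , c) = inj₁ (y , sumL e , c)
  ... | inj₂ m           = inj₂ (∈-++⁺ˡ m)
  ᾱ-derivative-source σ (w ⊕ w') (sumR s) with ᾱ-derivative-source σ w' s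
  ... | inj₁ (y , e , c) = inj₁ (y , sumR e , c)
  ... | inj₂ m           = inj₂ (∈-++⁺ʳ (exposedResiduals σ w) m)
  ᾱ-derivative-source σ (F w w') (fL Lᾱ≡true _) = ⊥-elim (true≢false Lᾱ≡true Lᾱ)
  ᾱ-derivative-source σ (F w w') (fR _ s) with ᾱ-derivative-source σ w' s
  ... | inj₁ (y , e , c) = inj₁ (y , argR e , c)
  ... | inj₂ m           = inj₂ (∈-map⁺ (inst σ w ∥_) m)

  -- T n has n + 1 pairwise non-bisimilar ᾱ-derivatives, but without an exposed variable σ(t₂) has
  -- at most size t₂ of them.
  F∼T⇒ᾱ-exposed : ∀ {n} σ t₁ t₂ → size t₂ < n → inst σ (F t₁ t₂) ∼ T n → ᾱ-Exposed σ t₂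
  F∼T⇒ᾱ-exposed {n} σ t₁ t₂ t₂<n F∼T = decidable-stable (ᾱ-exposed? σ t₂) not-unexposed
    where
    Residual : ℕ → Set₁
    Residual i = Σ Proc λ V → V ∈ exposedResiduals σ t₂ × inst σ t₁ ∥ V ∼ Tᾱ i

    residual : ¬ ᾱ-Exposed σ t₂ → (i : Fin (suc n)) → Residual (toℕ i)
    residual ¬e i with ∼-step⁻ F∼T (T-ᾱ (s≤s⁻¹ (toℕ<n i)))
    ... | _ , fL Lᾱ≡true _ , _ = ⊥-elim (true≢false Lᾱ≡true Lᾱ)
    ... | _ , fR _ s , b with ᾱ-derivative-source σ t₂ s
    ...   | inj₁ e = ⊥-elim (¬e e)
    ...   | inj₂ m = _ , m , b

    few-residuals : length (exposedResiduals σ t₂) < suc n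
    few-residuals = m<n⇒m<1+n (≤-<-trans (length-exposedResiduals σ t₂) t₂<n)

    not-unexposed : ¬ ¬ ᾱ-Exposed σ t₂
    not-unexposed ¬e with pigeonhole few-residuals (λ i → index (proj₁ (proj₂ (residual ¬e i))))
    ... | i , j , i<j , same-index with residual ¬e i | residual ¬e j
    ...   | V , m , bi | V' , m' , bj with index-injective (setoid Proc) m m' same-index
    ...     | refl = <⇒≱ i<j (∼Tᾱ-index-≤ bj bi)

  -- The marker ᾱ.τ: no process bisimilar to T n performs τ right after ᾱ.
  mark : (ℕ → Closed) → ℕ → ℕ → Closed
  mark σ y x with x ≟ y
  ... | yes _ = σ x ⊕ (Ā · τ · 𝟎)
  ... | no _  = σ x

  initials-⊆-mark : ∀ σ y x {μ} → Can (emb (σ x)) μ → Can (emb (mark σ y x)) μ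
  initials-⊆-mark σ y x (_ , s) with x ≟ y
  ... | yes _ = _ , sumL s
  ... | no _  = _ , s

  mark-⊆-initials : ∀ σ y → Can (emb (σ y)) Ā → ∀ x {μ} → Can (emb (mark σ y x)) μ → Can (emb (σ x)) μ
  mark-⊆-initials σ y σy-ᾱ x c with x ≟ y
  mark-⊆-initials σ y σy-ᾱ x c              | no _    = c
  mark-⊆-initials σ y σy-ᾱ x (_ , sumL s)   | yes _    = _ , s
  mark-⊆-initials σ y σy-ᾱ x (_ , sumR pre) | yes refl = σy-ᾱ

  marked-ᾱτ : ∀ σ {y w} → Exposed y w → Σ Proc λ D → inst (mark σ y) w —[ Ā ]→ D × Can D τ
  marked-ᾱτ σ {y} here with y ≟ y
  ... | yes _   = _ , sumR pre , _ , pre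
  ... | no y≢y = ⊥-elim (y≢y refl)
  marked-ᾱτ σ (sumL e) = let (D , s , c) = marked-ᾱτ σ e in D , sumL s , c
  marked-ᾱτ σ (sumR e) = let (D , s , c) = marked-ᾱτ σ e in D , sumR s , c
  marked-ᾱτ σ (argR e) = let (D , s , (_ , s')) = marked-ᾱτ σ e in _ , fR Rᾱ s , _ , parR s'

  marked-ᾱτ-source : ∀ σ y → Can (emb (σ y)) Ā → ∀ w {Y} → inst (mark σ y) w —[ Ā ]→ Y → Can Y τ →
      (Summand (var y) w × Y ≡ τ · 𝟎)
    ⊎ (Σ (Tm ℕ) λ w₁ → Σ (Tm ℕ) λ w₂ → Summand (F w₁ w₂) w × Can (inst σ w₂) Ā)
    ⊎ (Σ Proc λ Y₀ → inst σ w —[ Ā ]→ Y₀ × Can Y₀ τ)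
  marked-ᾱτ-source σ y σy-ᾱ (var x) s c with x ≟ y
  marked-ᾱτ-source σ y σy-ᾱ (var x) s          c | no _    = inj₂ (inj₂ (_ , s , c))
  marked-ᾱτ-source σ y σy-ᾱ (var x) (sumL s)   c | yes _    = inj₂ (inj₂ (_ , s , c))
  marked-ᾱτ-source σ y σy-ᾱ (var x) (sumR pre) c | yes refl = inj₁ (here v , refl)
  marked-ᾱτ-source σ y σy-ᾱ (μ · w) pre c = inj₂ (inj₂ (_ , pre , initials-mono (mark-⊆-initials σ y σy-ᾱ) w c))
  marked-ᾱτ-source σ y σy-ᾱ (w ⊕ w') (sumL s) c with marked-ᾱτ-source σ y σy-ᾱ w s c
  ... | inj₁ (h , e)                  = inj₁ (left h , e)
  ... | inj₂ (inj₁ (w₁ , w₂ , h , c')) = inj₂ (inj₁ (w₁ , w₂ , left h , c'))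
  ... | inj₂ (inj₂ (Y₀ , s₀ , c₀))     = inj₂ (inj₂ (Y₀ , sumL s₀ , c₀))
  marked-ᾱτ-source σ y σy-ᾱ (w ⊕ w') (sumR s) c with marked-ᾱτ-source σ y σy-ᾱ w' s c
  ... | inj₁ (h , e)                  = inj₁ (right h , e)
  ... | inj₂ (inj₁ (w₁ , w₂ , h , c')) = inj₂ (inj₁ (w₁ , w₂ , right h , c'))
  ... | inj₂ (inj₂ (Y₀ , s₀ , c₀))     = inj₂ (inj₂ (Y₀ , sumR s₀ , c₀))
  marked-ᾱτ-source σ y σy-ᾱ (F w w') (fL Lᾱ≡true _) _ = ⊥-elim (true≢false Lᾱ≡true Lᾱ)
  marked-ᾱτ-source σ y σy-ᾱ (F w w') (fR _ s) _ =
    inj₂ (inj₁ (w , w' , here f , initials-mono (mark-⊆-initials σ y σy-ᾱ) w' (_ , s)))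

  HasSummand∼T : Closed → ℕ → Set₁
  HasSummand∼T p n = Σ Closed λ s → Summand s p × emb s ∼ T n

  F-summand∼T : ∀ {u u₁ u₂ n} σ → Summand (F u₁ u₂) u → ¬ HasZeroFactor ρ (subst σ u) →
    inst σ u ∼ T n → Can (inst σ u₂) Ā → HasSummand∼T (subst σ u) n
  F-summand∼T {u} {u₁} {u₂} σ h no𝟎 σu∼T σu₂-ᾱ = subst σ (F u₁ u₂) , h' , F-∼T (summand-step h') σu∼T σu₁≁𝟎 σu₂-ᾱ
    where
    h' : Summand (subst σ (F u₁ u₂)) (subst σ u)
    h' = summand-subst-trans σ (here f) h
    σu₁≁𝟎 : ¬ inst σ u₁ ∼ 𝟎
    σu₁≁𝟎 b = no𝟎 (subst σ u₁ , subst σ u₂ , summand-subterm h' , inj₁ b)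

  marked-transfer : ∀ {n} t u → Sound ρ t u → ∀ σ → ¬ HasZeroFactor ρ (subst σ u) → inst σ u ∼ T n →
    ∀ y → Can (emb (σ y)) Ā → ∀ {D} → inst (mark σ y) t —[ Ā ]→ D → Can D τ →
    (Summand (var y) u → HasSummand∼T (subst σ u) n) ⊎ Can D A → HasSummand∼T (subst σ u) n
  marked-transfer t u t≈u σ no𝟎 σu∼T y σy-ᾱ t→D (_ , D-τ) var-case with ∼-step (t≈u (mark σ y)) t→D
  ... | Y , u→Y , D∼Y with marked-ᾱτ-source σ y σy-ᾱ u u→Y (let (Y' , s , _) = ∼-step D∼Y D-τ in Y' , s)
  ...   | inj₂ (inj₂ (_ , s , c))         = ⊥-elim (∼T-ᾱ-no-τ σu∼T s c)
  ...   | inj₂ (inj₁ (_ , _ , h , σu₂-ᾱ)) = F-summand∼T σ h no𝟎 σu∼T σu₂-ᾱ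
  ...   | inj₁ (h , refl) with var-case
  ...     | inj₁ k            = k h
  ...     | inj₂ (_ , D-α) with ∼-step D∼Y D-α
  ...       | _ , () , _

  var-summand-case : ∀ {n x s} t u → Sound ρ t u → ∀ σ → ¬ HasZeroFactor ρ (subst σ u) → inst σ u ∼ T n →
    Summand (var x) t → Summand s (σ x) → emb s ∼ T n → HasSummand∼T (subst σ u) n
  var-summand-case {x = x} {s} t u t≈u σ no𝟎 σu∼T x∈t s∈σx s∼T =
    let (_ , t→D , D-τ) = marked-ᾱτ σ (summand-var-exposed x∈t) in
    marked-transfer t u t≈u σ no𝟎 σu∼T x σx-ᾱ t→D D-τ (inj₁ λ x∈u → s , summand-subst-trans σ s∈σx x∈u , s∼T)
    where
    σx-ᾱ : Can (emb (σ x)) Ā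
    σx-ᾱ = let (_ , s→ , _) = ∼-step⁻ s∼T (T-ᾱ z≤n) in _ , summand-step s∈σx s→

  F-summand-case : ∀ {n t₁ t₂} t u → Sound ρ t u → ∀ σ → ¬ HasZeroFactor ρ (subst σ u) → inst σ u ∼ T n →
    size t < n → Summand (F t₁ t₂) t → inst σ (F t₁ t₂) ∼ T n → HasSummand∼T (subst σ u) n
  F-summand-case {n} {t₁} {t₂} t u t≈u σ no𝟎 σu∼T size<n F∈t F∼T =
    let (y , e , σy-ᾱ) = F∼T⇒ᾱ-exposed σ t₁ t₂ t₂<n F∼T
        (_ , t₂→D , D-τ) = marked-ᾱτ σ e
        (_ , t₁→) = initials-mono (initials-⊆-mark σ y) t₁ (F∼T⇒left-α F∼T)
        F∈t' = summand-subst-trans (mark σ y) (here f) F∈t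
    in marked-transfer t u t≈u σ no𝟎 σu∼T y σy-ᾱ (summand-step F∈t' (fR Rᾱ t₂→D)) (_ , parR (proj₂ D-τ)) (inj₂ (_ , parL t₁→))
    where
    t₂<n : size t₂ < n
    t₂<n = <-trans (<-≤-trans (s≤s (m≤n+m (size t₂) (size t₁))) (summand-size F∈t)) size<n

  summand∼T-transfer : ∀ {n} t u → Sound ρ t u → ∀ σ → ¬ HasZeroFactor ρ (subst σ u) →
    size t < n → inst σ u ∼ T n → HasSummand∼T (subst σ t) n → HasSummand∼T (subst σ u) n
  summand∼T-transfer t u t≈u σ no𝟎 size<n σu∼T (s , s∈σt , s∼T) with summand-origin σ t s∈σt
  ... | _ , x∈t , var s∈σx = var-summand-case t u t≈u σ no𝟎 σu∼T x∈t s∈σx s∼T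
  ... | _ , _   , nil      = ⊥-elim (𝟎-≁T s∼T)
  ... | _ , _   , prefix   = ⊥-elim (prefix-≁T s∼T)
  ... | _ , F∈t , fun      = F-summand-case t u t≈u σ no𝟎 σu∼T size<n F∈t s∼T

proposition12 : (ρ : Rules) → Standing ρ → (α : Name) →
  L ρ (vis α) ≡ true → R ρ (vis α) ≡ false →
  R ρ (vis (bar α)) ≡ true → L ρ (vis (bar α)) ≡ false →
  S ρ (bar α) ≡ true → S ρ α ≡ false →
  (t u : Tm ℕ) → Sound ρ t u → (σ : ℕ → Closed) →
  ¬ HasZeroSummand ρ (subst σ t) → ¬ HasZeroFactor ρ (subst σ t) →
  ¬ HasZeroSummand ρ (subst σ u) → ¬ HasZeroFactor ρ (subst σ u) →
  (n : ℕ) → size t < n →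
  ρ ⊢ subst σ t ↔ target α n → ρ ⊢ subst σ u ↔ target α n →
  Σ Closed (λ s → Summand s (subst σ t) × ρ ⊢ s ↔ target α n) →
  Σ Closed (λ s → Summand s (subst σ u) × ρ ⊢ s ↔ target α n)
proposition12 ρ _ α Lα Rα Rᾱ Lᾱ _ Sα t u t≈u σ _ _ _ no𝟎 n size<n _ σu∼T =
  Target.summand∼T-transfer ρ α Lα Rα Rᾱ Lᾱ Sα t u t≈u σ no𝟎 size<n σu∼T
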